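{- Let $p$ be an odd prime and $A=Q_p=U(p)^2$. A sequence $S:(x,y)$ in $\mathbb{Z}_p$ is an $A$-extremal sequence in $\mathbb{Z}_p$ if and only if $x,y\in U(p)$ and $x$ and $-y$ lie in different cosets of $A$ in $U(p)$.
   Context: $\mathbb{Z}_p=\mathbb{Z}/p\mathbb{Z}$, $U(p)$ its group of units, $U(p)^2=\{x^2:x\in U(p)\}$. For $B\subseteq\mathbb{Z}_p\setminus\{0\}$, a sequence $(x_1,\ldots,x_k)$ ($k\ge1$) in $\mathbb{Z}_p$ is a $B$-weighted zero-sum sequence if there exist $b_1,\ldots,b_k\in B$ with $b_1x_1+\cdots+b_kx_k=0$. A subsequence of consecutive terms is a nonempty block $(x_i,\ldots,x_j)$. $C_B(p)$ is the least positive integer $k$ such that every sequence of length $k$ in $\mathbb{Z}_p$ has a $B$-weighted zero-sum subsequence of consecutive terms. A sequence in $\mathbb{Z}_p$ is $B$-extremal if it has length $C_B(p)-1$ and has no $B$-weighted zero-sum subsequence of consecutive terms. -}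

module Defs where

open import Data.Nat as ℕ using (ℕ; zero; suc; NonZero; _<_; _∸_)
open import Data.Nat.DivMod using (_mod_)
open import Data.Fin using (Fin; toℕ)
open import Data.List using (List; []; _∷_; length; _++_)
open import Data.Product using (Σ; ∃; _×_; _,_)
open import Relation.Binary.PropositionalEquality using (_≡_; _≢_)
open import Relation.Nullary using (¬_)

module _ (p : ℕ) .{{_ : NonZero p}} where

  Zp : Set
  Zp = Fin p

  0ₚ : Zp
  0ₚ = 0 mod p

  infixl 6 _+ₚ_
  infixl 7 _*ₚ_

  _+ₚ_ : Zp → Zp → Zp
  x +ₚ y = (toℕ x ℕ.+ toℕ y) mod p

  _*ₚ_ : Zp → Zp → Zp
  x *ₚ y = (toℕ x ℕ.* toℕ y) mod p

  -ₚ_ : Zp → Zp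
  -ₚ x = (p ∸ toℕ x) mod p

  IsUnit : Zp → Set
  IsUnit x = ∃ λ y → x *ₚ y ≡ 1 mod p

  InSquares : Zp → Set
  InSquares z = ∃ λ x → IsUnit x × z ≡ x *ₚ x

  -- weighted sum  b₁x₁ + ... + b_k x_k  (0 if lengths differ is never used:
  -- the weights list is required to have the same length)
  wsum : List Zp → List Zp → Zp
  wsum (b ∷ bs) (x ∷ xs) = b *ₚ x +ₚ wsum bs xs
  wsum _ _ = 0ₚ

  data AllIn (B : Zp → Set) : List Zp → Set where
    []  : AllIn B []
    _∷_ : ∀ {b bs} → B b → AllIn B bs → AllIn B (b ∷ bs)

  WZeroSum : (Zp → Set) → List Zp → Set
  WZeroSum B xs = (0 ℕ.< length xs) ×
    (∃ λ bs → length bs ≡ length xs × AllIn B bs × wsum bs xs ≡ 0ₚ)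

  HasZSBlock : (Zp → Set) → List Zp → Set
  HasZSBlock B xs = ∃ λ pre → ∃ λ mid → ∃ λ post →
    xs ≡ pre ++ mid ++ post × WZeroSum B mid

  Prop-k : (Zp → Set) → ℕ → Set
  Prop-k B k = ∀ (xs : List Zp) → length xs ≡ k → HasZSBlock B xs

  IsC : (Zp → Set) → ℕ → Set
  IsC B c = (0 ℕ.< c) × Prop-k B c × (∀ j → 0 ℕ.< j → j ℕ.< c → ¬ Prop-k B j)

  Extremal : (Zp → Set) → List Zp → Set
  Extremal B xs = ∃ λ c → IsC B c × length xs ≡ c ∸ 1 × ¬ HasZSBlock B xs

  SameCoset : (Zp → Set) → Zp → Zp → Set
  SameCoset A x z = ∃ λ a → A a × x ≡ a *ₚ z

-- A zero term is a singleton block, and for units x, y the pair (x, y) is an A-weighted zero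
-- sum exactly when x ∈ (−y)A; so (x, y) is blockless iff x, y ∈ U(p) and x ∉ (−y)A, and it
-- remains to show C_A(p) = 3. If neither (u, v) nor (v, w) is a block, then u = r(−v) and
-- v = q(−w) with nonsquares r, q. Since A has index 2 in U(p) (the squares of 1, …, (p − 1)/2
-- and their multiples by a nonsquare are p − 1 distinct units), rq is a square, and a square e
-- with e + 1 a nonsquare yields square weights making u, v, w a zero sum.

module Submission where

open import Data.Nat using (ℕ; NonZero)
open import Data.Nat.Primality using (Prime)
open import Data.List using (List; []; _∷_)
open import Data.Product using (_×_)
open import Relation.Binary.PropositionalEquality using (_≢_)
open import Relation.Nullary using (¬_)
open import Function.Bundles using (_⇔_)
open import Defs

open import Level using (0ℓ)
open import Data.Nat as ℕ using (zero; suc; _%_; z≤n; s≤s)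
import Data.Nat.Properties as ℕ
open import Data.Nat.DivMod using (_mod_; %-distribˡ-+; %-distribˡ-*; n%n≡0; m<n⇒m%n≡m; m≡m%n+[m/n]*n; m%n<n)
open import Data.Nat.Divisibility using (m%n≡0⇒n∣m)
open import Data.Nat.Primality using (prime⇒irreducible; prime⇒nonTrivial)
open import Data.Nat.Coprimality using (prime⇒coprime; coprime-Bézout)
open import Data.Nat.GCD using (module Bézout)
open import Data.Fin as Fin using (Fin; toℕ; _≟_; splitAt; join)
open import Data.Fin.Properties using (toℕ-injective; toℕ-fromℕ<; toℕ<n; any?; ¬∀⟶∃¬; injective⇒≤; join-splitAt)
open import Data.List using (length; _++_; take; drop)
open import Data.List.Properties using (++-assoc; length-take; take++drop≡id)
open import Data.Product using (∃; _,_; proj₁; proj₂)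
import Data.Product as Product
open import Data.Sum using (_⊎_; inj₁; inj₂; [_,_])
import Data.Sum as Sum
open import Function using (_∘_)
open import Function.Bundles using (mk⇔; Equivalence)
open import Function.Definitions using (Injective)
open import Relation.Binary.PropositionalEquality
  using (_≡_; refl; sym; trans; cong; cong₂; subst; subst₂; isEquivalence; module ≡-Reasoning)
open import Relation.Nullary using (Dec; yes; no; contradiction)
open import Relation.Nullary.Decidable using (_×-dec_; _⊎-dec_; ¬?; map′; decidable-stable)
open import Algebra.Bundles using (CommutativeRing)
open import Algebra.Consequences.Propositional using (comm∧idˡ⇒id; comm∧invˡ⇒inv; comm∧distrˡ⇒distrʳ)

module _ (p : ℕ) .{{_ : NonZero p}} {B : Zp p → Set} where

  hasZSBlock-++ʳ : ∀ {xs} ys → HasZSBlock p B xs → HasZSBlock p B (xs ++ ys)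
  hasZSBlock-++ʳ ys (pre , mid , post , refl , zs) = pre , mid , post ++ ys , eq , zs
    where
    eq : (pre ++ mid ++ post) ++ ys ≡ pre ++ mid ++ post ++ ys
    eq = trans (++-assoc pre (mid ++ post) ys) (cong (pre ++_) (++-assoc mid post ys))

  hasZSBlock-++ˡ : ∀ xs {ys} → HasZSBlock p B ys → HasZSBlock p B (xs ++ ys)
  hasZSBlock-++ˡ xs (pre , mid , post , refl , zs) =
    xs ++ pre , mid , post , sym (++-assoc xs pre (mid ++ post)) , zs

  -- Prefixes of a blockless sequence are blockless, so no shorter length has the defining property.
  blockless⇒extremal : ∀ {xs} → Prop-k p B (suc (length xs)) → ¬ HasZSBlock p B xs →
                       Extremal p B xs
  blockless⇒extremal {xs} allBlocked ¬block =
    suc (length xs) , (s≤s z≤n , allBlocked , shorter) , refl , ¬block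
    where
    shorter : ∀ j → 0 ℕ.< j → j ℕ.< suc (length xs) → ¬ Prop-k p B j
    shorter j _ (s≤s j≤n) prop = ¬block (subst (HasZSBlock p B) (take++drop≡id j xs)
      (hasZSBlock-++ʳ (drop j xs) (prop (take j xs) (trans (length-take j xs) (ℕ.m≤n⇒m⊓n≡m j≤n)))))

module ZpRing (p : ℕ) .{{_ : NonZero p}} where

  ⟦_⟧ : ℕ → Zp p
  ⟦ n ⟧ = n mod p

  private
    infix  8 -_
    infixl 6 _+_
    infixl 7 _*_

    _+_ _*_ : Zp p → Zp p → Zp p
    _+_ = _+ₚ_ p
    _*_ = _*ₚ_ p

    -_ : Zp p → Zp p
    -_ = -ₚ_ p

    0# 1# : Zp p
    0# = 0ₚ p
    1# = ⟦ 1 ⟧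

  toℕ-⟦⟧ : ∀ n → toℕ ⟦ n ⟧ ≡ n % p
  toℕ-⟦⟧ n = toℕ-fromℕ< _

  toℕ-⟦⟧-< : ∀ {n} → n ℕ.< p → toℕ ⟦ n ⟧ ≡ n
  toℕ-⟦⟧-< n<p = trans (toℕ-⟦⟧ _) (m<n⇒m%n≡m n<p)

  ⟦toℕ⟧ : ∀ x → ⟦ toℕ x ⟧ ≡ x
  ⟦toℕ⟧ x = toℕ-injective (toℕ-⟦⟧-< (toℕ<n x))

  ⟦⟧-+ : ∀ m n → ⟦ m ℕ.+ n ⟧ ≡ ⟦ m ⟧ + ⟦ n ⟧
  ⟦⟧-+ m n = toℕ-injective (begin
    toℕ ⟦ m ℕ.+ n ⟧                ≡⟨ toℕ-⟦⟧ (m ℕ.+ n) ⟩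
    (m ℕ.+ n) % p                  ≡⟨ %-distribˡ-+ m n p ⟩
    (m % p ℕ.+ n % p) % p          ≡⟨ cong₂ (λ a b → (a ℕ.+ b) % p) (toℕ-⟦⟧ m) (toℕ-⟦⟧ n) ⟨
    (toℕ ⟦ m ⟧ ℕ.+ toℕ ⟦ n ⟧) % p  ≡⟨ toℕ-⟦⟧ _ ⟨
    toℕ (⟦ m ⟧ + ⟦ n ⟧)            ∎)
    where open ≡-Reasoning

  ⟦⟧-* : ∀ m n → ⟦ m ℕ.* n ⟧ ≡ ⟦ m ⟧ * ⟦ n ⟧
  ⟦⟧-* m n = toℕ-injective (begin
    toℕ ⟦ m ℕ.* n ⟧                ≡⟨ toℕ-⟦⟧ (m ℕ.* n) ⟩
    (m ℕ.* n) % p                  ≡⟨ %-distribˡ-* m n p ⟩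
    (m % p ℕ.* (n % p)) % p        ≡⟨ cong₂ (λ a b → (a ℕ.* b) % p) (toℕ-⟦⟧ m) (toℕ-⟦⟧ n) ⟨
    (toℕ ⟦ m ⟧ ℕ.* toℕ ⟦ n ⟧) % p  ≡⟨ toℕ-⟦⟧ _ ⟨
    toℕ (⟦ m ⟧ * ⟦ n ⟧)            ∎)
    where open ≡-Reasoning

  toℕ-0 : toℕ 0# ≡ 0
  toℕ-0 = toℕ-⟦⟧-< (ℕ.>-nonZero⁻¹ p)

  toℕ≡0⇒≡0 : ∀ x → toℕ x ≡ 0 → x ≡ 0#
  toℕ≡0⇒≡0 x toℕx≡0 = toℕ-injective (trans toℕx≡0 (sym toℕ-0))

  ≢0⇒≡⟦1+k⟧ : ∀ x → x ≢ 0# → ∃ λ k → suc k ℕ.< p × ⟦ suc k ⟧ ≡ x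
  ≢0⇒≡⟦1+k⟧ x x≢0 = fromToℕ (toℕ x) refl
    where
    fromToℕ : ∀ n → toℕ x ≡ n → ∃ λ k → suc k ℕ.< p × ⟦ suc k ⟧ ≡ x
    fromToℕ zero    toℕx≡0   = contradiction (toℕ≡0⇒≡0 x toℕx≡0) x≢0
    fromToℕ (suc k) toℕx≡1+k =
      k , subst (ℕ._< p) toℕx≡1+k (toℕ<n x) , trans (cong ⟦_⟧ (sym toℕx≡1+k)) (⟦toℕ⟧ x)

  ⟦⟧≢0 : ∀ {n} → 0 ℕ.< n → n ℕ.< p → ⟦ n ⟧ ≢ 0#
  ⟦⟧≢0 0<n n<p ⟦n⟧≡0 = ℕ.>⇒≢ 0<n (trans (sym (toℕ-⟦⟧-< n<p)) (trans (cong toℕ ⟦n⟧≡0) toℕ-0))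

  ⟦p⟧≡0 : ⟦ p ⟧ ≡ 0#
  ⟦p⟧≡0 = toℕ-injective (trans (toℕ-⟦⟧ p) (trans (n%n≡0 p) (sym toℕ-0)))

  private
    +-assoc : ∀ x y z → (x + y) + z ≡ x + (y + z)
    +-assoc x y z = begin
      (x + y) + z          ≡⟨ cong ((x + y) +_) (⟦toℕ⟧ z) ⟨
      ⟦ a ℕ.+ b ⟧ + ⟦ c ⟧  ≡⟨ ⟦⟧-+ (a ℕ.+ b) c ⟨
      ⟦ a ℕ.+ b ℕ.+ c ⟧    ≡⟨ cong ⟦_⟧ (ℕ.+-assoc a b c) ⟩
      ⟦ a ℕ.+ (b ℕ.+ c) ⟧  ≡⟨ ⟦⟧-+ a (b ℕ.+ c) ⟩
      ⟦ a ⟧ + ⟦ b ℕ.+ c ⟧  ≡⟨ cong (_+ (y + z)) (⟦toℕ⟧ x) ⟩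
      x + (y + z)          ∎
      where open ≡-Reasoning; a = toℕ x; b = toℕ y; c = toℕ z

    *-assoc : ∀ x y z → (x * y) * z ≡ x * (y * z)
    *-assoc x y z = begin
      (x * y) * z          ≡⟨ cong ((x * y) *_) (⟦toℕ⟧ z) ⟨
      ⟦ a ℕ.* b ⟧ * ⟦ c ⟧  ≡⟨ ⟦⟧-* (a ℕ.* b) c ⟨
      ⟦ a ℕ.* b ℕ.* c ⟧    ≡⟨ cong ⟦_⟧ (ℕ.*-assoc a b c) ⟩
      ⟦ a ℕ.* (b ℕ.* c) ⟧  ≡⟨ ⟦⟧-* a (b ℕ.* c) ⟩
      ⟦ a ⟧ * ⟦ b ℕ.* c ⟧  ≡⟨ cong (_* (y * z)) (⟦toℕ⟧ x) ⟩
      x * (y * z)          ∎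
      where open ≡-Reasoning; a = toℕ x; b = toℕ y; c = toℕ z

    *-distribˡ-+ : ∀ x y z → x * (y + z) ≡ x * y + x * z
    *-distribˡ-+ x y z = begin
      x * (y + z)              ≡⟨ cong (_* (y + z)) (⟦toℕ⟧ x) ⟨
      ⟦ a ⟧ * ⟦ b ℕ.+ c ⟧      ≡⟨ ⟦⟧-* a (b ℕ.+ c) ⟨
      ⟦ a ℕ.* (b ℕ.+ c) ⟧      ≡⟨ cong ⟦_⟧ (ℕ.*-distribˡ-+ a b c) ⟩
      ⟦ a ℕ.* b ℕ.+ a ℕ.* c ⟧  ≡⟨ ⟦⟧-+ (a ℕ.* b) (a ℕ.* c) ⟩
      x * y + x * z            ∎
      where open ≡-Reasoning; a = toℕ x; b = toℕ y; c = toℕ z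

    +-comm : ∀ x y → x + y ≡ y + x
    +-comm x y = cong ⟦_⟧ (ℕ.+-comm (toℕ x) (toℕ y))

    *-comm : ∀ x y → x * y ≡ y * x
    *-comm x y = cong ⟦_⟧ (ℕ.*-comm (toℕ x) (toℕ y))

    +-identityˡ : ∀ x → 0# + x ≡ x
    +-identityˡ x = begin
      0# + x             ≡⟨ cong (0# +_) (⟦toℕ⟧ x) ⟨
      ⟦ 0 ⟧ + ⟦ toℕ x ⟧  ≡⟨ ⟦⟧-+ 0 (toℕ x) ⟨
      ⟦ toℕ x ⟧          ≡⟨ ⟦toℕ⟧ x ⟩
      x                  ∎
      where open ≡-Reasoning

    *-identityˡ : ∀ x → 1# * x ≡ x
    *-identityˡ x = begin
      1# * x             ≡⟨ cong (1# *_) (⟦toℕ⟧ x) ⟨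
      ⟦ 1 ⟧ * ⟦ toℕ x ⟧  ≡⟨ ⟦⟧-* 1 (toℕ x) ⟨
      ⟦ 1 ℕ.* toℕ x ⟧    ≡⟨ cong ⟦_⟧ (ℕ.*-identityˡ (toℕ x)) ⟩
      ⟦ toℕ x ⟧          ≡⟨ ⟦toℕ⟧ x ⟩
      x                  ∎
      where open ≡-Reasoning

    -‿inverseˡ : ∀ x → - x + x ≡ 0#
    -‿inverseˡ x = begin
      - x + x                      ≡⟨ cong (- x +_) (⟦toℕ⟧ x) ⟨
      ⟦ p ℕ.∸ toℕ x ⟧ + ⟦ toℕ x ⟧  ≡⟨ ⟦⟧-+ (p ℕ.∸ toℕ x) (toℕ x) ⟨
      ⟦ p ℕ.∸ toℕ x ℕ.+ toℕ x ⟧    ≡⟨ cong ⟦_⟧ (ℕ.m∸n+n≡m (ℕ.<⇒≤ (toℕ<n x))) ⟩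
      ⟦ p ⟧                        ≡⟨ ⟦p⟧≡0 ⟩
      0#                           ∎
      where open ≡-Reasoning

  commutativeRing : CommutativeRing 0ℓ 0ℓ
  commutativeRing = record
    { _+_ = _+_ ; _*_ = _*_ ; -_ = -_ ; 0# = 0# ; 1# = 1#
    ; isCommutativeRing = record
      { isRing = record
        { +-isAbelianGroup = record
          { isGroup = record
            { isMonoid = record
              { isSemigroup = record
                { isMagma = record { isEquivalence = isEquivalence ; ∙-cong = cong₂ _+_ }
                ; assoc = +-assoc
                }
              ; identity = comm∧idˡ⇒id +-comm +-identityˡ
              }
            ; inverse = comm∧invˡ⇒inv +-comm -‿inverseˡ
            ; ⁻¹-cong = cong -_
            }
          ; comm = +-comm
          }
        ; *-cong = cong₂ _*_
        ; *-assoc = *-assoc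
        ; *-identity = comm∧idˡ⇒id *-comm *-identityˡ
        ; distrib = *-distribˡ-+ , comm∧distrˡ⇒distrʳ *-comm *-distribˡ-+
        }
      ; *-comm = *-comm
      }
    }

module ZpSquares (p : ℕ) .{{_ : NonZero p}} where

  open ZpRing p public
  open CommutativeRing commutativeRing public
    using (_+_; _*_; -_; _-_; 0#; 1#; +-assoc; +-comm; +-identityˡ; +-identityʳ; -‿inverseˡ; -‿inverseʳ; zeroˡ;
           *-assoc; *-comm; *-identityˡ; *-identityʳ; zeroʳ; ring; *-commutativeSemigroup;
           commutativeSemiring)
  open import Algebra.Properties.Ring ring public
    using (-‿distribʳ-*; -‿involutive; +-inverseʳ-unique; +-inverseˡ-unique; +-cancelʳ; x∙y⁻¹≈ε⇒x≈y)
  open import Algebra.Properties.CommutativeSemigroup *-commutativeSemigroup public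
    using (interchange)
  open import Algebra.Solver.Ring.NaturalCoefficients.Default commutativeSemiring public
    using (solve; _:+_; _:*_; _:=_; con)

  ⟦⟧-*-toℕ : ∀ m x → ⟦ m ℕ.* toℕ x ⟧ ≡ ⟦ m ⟧ * x
  ⟦⟧-*-toℕ m x = trans (⟦⟧-* m (toℕ x)) (cong (⟦ m ⟧ *_) (⟦toℕ⟧ x))

  ⟦k*p⟧≡0 : ∀ k → ⟦ k ℕ.* p ⟧ ≡ 0#
  ⟦k*p⟧≡0 k = trans (⟦⟧-* k p) (trans (cong (⟦ k ⟧ *_) ⟦p⟧≡0) (zeroʳ ⟦ k ⟧))

  Unit Sq : Zp p → Set
  Unit = IsUnit p
  Sq = InSquares p

  infix 4 _∼_
  _∼_ : Zp p → Zp p → Set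
  _∼_ = SameCoset p Sq

  unit? : ∀ x → Dec (Unit x)
  unit? x = any? (λ y → x * y ≟ 1#)

  square? : ∀ x → Dec (Sq x)
  square? x = any? (λ y → unit? y ×-dec x ≟ y * y)

  sameCoset? : ∀ x z → Dec (x ∼ z)
  sameCoset? x z = any? (λ a → square? a ×-dec x ≟ a * z)

  unit-solveˡ : ∀ b b' x {z} → b * b' ≡ 1# → b * x ≡ z → x ≡ b' * z
  unit-solveˡ b b' x {z} bb'≡1 bx≡z = begin
    x              ≡⟨ *-identityˡ x ⟨
    1# * x         ≡⟨ cong (_* x) (trans (sym bb'≡1) (*-comm b b')) ⟩
    (b' * b) * x   ≡⟨ *-assoc b' b x ⟩
    b' * (b * x)   ≡⟨ cong (b' *_) bx≡z ⟩
    b' * z         ∎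
    where open ≡-Reasoning

  unit-*-cancelʳ : ∀ n a b → Unit n → a * n ≡ b * n → a ≡ b
  unit-*-cancelʳ n a b (n' , nn'≡1) an≡bn = begin
    a               ≡⟨ unit-solveˡ n n' a nn'≡1 (*-comm n a) ⟩
    n' * (a * n)    ≡⟨ cong (n' *_) an≡bn ⟩
    n' * (b * n)    ≡⟨ unit-solveˡ n n' b nn'≡1 (*-comm n b) ⟨
    b               ∎
    where open ≡-Reasoning

  unit-* : ∀ x y → Unit x → Unit y → Unit (x * y)
  unit-* x y (x' , xx'≡1) (y' , yy'≡1) =
    x' * y' , trans (interchange x y x' y') (trans (cong₂ _*_ xx'≡1 yy'≡1) (*-identityˡ 1#))

  unit-inverse : ∀ x x' → x * x' ≡ 1# → Unit x'
  unit-inverse x x' xx'≡1 = x , trans (*-comm x' x) xx'≡1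

  unit-neg : ∀ x → Unit x → Unit (- x)
  unit-neg x (y , xy≡1) = - y , (begin
    - x * - y      ≡⟨ -‿distribʳ-* (- x) y ⟨
    - (- x * y)    ≡⟨ cong -_ (trans (*-comm (- x) y) (sym (-‿distribʳ-* y x))) ⟩
    - - (y * x)    ≡⟨ -‿involutive (y * x) ⟩
    y * x          ≡⟨ trans (*-comm y x) xy≡1 ⟩
    1#             ∎)
    where open ≡-Reasoning

  square-1 : Sq 1#
  square-1 = 1# , (1# , *-identityˡ 1#) , sym (*-identityˡ 1#)

  x*x-square : ∀ x → Unit x → Sq (x * x)
  x*x-square x ux = x , ux , refl

  square⇒unit : ∀ a → Sq a → Unit a
  square⇒unit _ (x , ux , refl) = unit-* x x ux ux

  square-* : ∀ a b → Sq a → Sq b → Sq (a * b)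
  square-* _ _ (x , ux , refl) (y , uy , refl) = x * y , unit-* x y ux uy , interchange x x y y

  square-inverse : ∀ a b → Sq a → a * b ≡ 1# → Sq b
  square-inverse _ b (x , (x' , xx'≡1) , refl) ab≡1 = x' , unit-inverse x x' xx'≡1 , (begin
    b               ≡⟨ unit-solveˡ (x * x) (x' * x') b x²x'²≡1 ab≡1 ⟩
    (x' * x') * 1#  ≡⟨ *-identityʳ (x' * x') ⟩
    x' * x'         ∎)
    where
    open ≡-Reasoning
    x²x'²≡1 : (x * x) * (x' * x') ≡ 1#
    x²x'²≡1 = trans (interchange x x x' x') (trans (cong₂ _*_ xx'≡1 xx'≡1) (*-identityˡ 1#))

  square-cancelˡ : ∀ a n → Sq a → Sq (a * n) → Sq n
  square-cancelˡ a n sa san with square⇒unit a sa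
  ... | a' , aa'≡1 = subst Sq (sym (unit-solveˡ a a' n aa'≡1 refl))
                       (square-* a' (a * n) (square-inverse a a' sa aa'≡1) san)

  ¬sameCoset⇒nonsquareRatio : ∀ x z → Unit x → Unit z → ¬ x ∼ z →
                              ∃ λ r → Unit r × ¬ Sq r × x ≡ r * z
  ¬sameCoset⇒nonsquareRatio x z ux (z' , zz'≡1) x≁z =
    x * z' , unit-* x z' ux (unit-inverse z z' zz'≡1) , (λ sr → x≁z (x * z' , sr , x≡rz)) , x≡rz
    where
    x≡rz : x ≡ (x * z') * z
    x≡rz = sym (trans (*-assoc x z' z) (trans (cong (x *_) (trans (*-comm z' z) zz'≡1)) (*-identityʳ x)))

  x*x≡y*y⇒[x+y][x-y]≡0 : ∀ x y → x * x ≡ y * y → (x + y) * (x - y) ≡ 0#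
  x*x≡y*y⇒[x+y][x-y]≡0 x y x²≡y² = +-cancelʳ (y * y) _ 0# (begin
    (x + y) * (x - y) + y * y    ≡⟨ expand (- y) ⟩
    x * x + (x + y) * (y - y)    ≡⟨ cong (λ z → x * x + (x + y) * z) (-‿inverseʳ y) ⟩
    x * x + (x + y) * 0#         ≡⟨ cong (x * x +_) (zeroʳ (x + y)) ⟩
    x * x + 0#                   ≡⟨ +-identityʳ (x * x) ⟩
    x * x                        ≡⟨ x²≡y² ⟩
    y * y                        ≡⟨ +-identityˡ (y * y) ⟨
    0# + y * y                   ∎)
    where
    open ≡-Reasoning
    -- −y is abstracted to n so that this is a semiring identity.
    expand : ∀ n → (x + y) * (x + n) + y * y ≡ x * x + (x + y) * (y + n)
    expand = solve 3 (λ x y n → (x :+ y) :* (x :+ n) :+ y :* y := x :* x :+ (x :+ y) :* (y :+ n)) refl x y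

  ≡0⇒wZeroSum-[x] : ∀ x → x ≡ 0# → WZeroSum p Sq (x ∷ [])
  ≡0⇒wZeroSum-[x] x x≡0 =
    s≤s z≤n , 1# ∷ [] , refl , square-1 ∷ [] , trans (+-identityʳ (1# * x)) (trans (*-identityˡ x) x≡0)

  wZeroSum-[x]⇒≡0 : ∀ x → WZeroSum p Sq (x ∷ []) → x ≡ 0#
  wZeroSum-[x]⇒≡0 x (_ , [] , () , _)
  wZeroSum-[x]⇒≡0 x (_ , _ ∷ _ ∷ _ , () , _)
  wZeroSum-[x]⇒≡0 x (_ , b ∷ [] , refl , sb ∷ [] , bx+0≡0) with square⇒unit b sb
  ... | b' , bb'≡1 =
    trans (unit-solveˡ b b' x bb'≡1 (trans (sym (+-identityʳ (b * x))) bx+0≡0)) (zeroʳ b')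

  ∼⇒wZeroSum-[x,y] : ∀ x y → x ∼ - y → WZeroSum p Sq (x ∷ y ∷ [])
  ∼⇒wZeroSum-[x,y] x y (a , sa , x≡a[-y]) = s≤s z≤n , 1# ∷ a ∷ [] , refl , square-1 ∷ sa ∷ [] , (begin
    1# * x + (a * y + 0#)  ≡⟨ cong₂ _+_ (trans (*-identityˡ x) x≡a[-y]) (+-identityʳ (a * y)) ⟩
    a * - y + a * y        ≡⟨ cong (_+ a * y) (-‿distribʳ-* a y) ⟨
    - (a * y) + a * y      ≡⟨ -‿inverseˡ (a * y) ⟩
    0#                     ∎)
    where open ≡-Reasoning

  wZeroSum-[x,y]⇒∼ : ∀ x y → WZeroSum p Sq (x ∷ y ∷ []) → x ∼ - y
  wZeroSum-[x,y]⇒∼ x y (_ , [] , () , _)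
  wZeroSum-[x,y]⇒∼ x y (_ , _ ∷ [] , () , _)
  wZeroSum-[x,y]⇒∼ x y (_ , _ ∷ _ ∷ _ ∷ _ , () , _)
  wZeroSum-[x,y]⇒∼ x y (_ , b ∷ c ∷ [] , refl , sb ∷ sc ∷ [] , sum≡0) with square⇒unit b sb
  ... | b' , bb'≡1 = b' * c , square-* b' c (square-inverse b b' sb bb'≡1) sc , (begin
    x                ≡⟨ unit-solveˡ b b' x bb'≡1 bx≡-cy ⟩
    b' * - (c * y)   ≡⟨ cong (b' *_) (-‿distribʳ-* c y) ⟩
    b' * (c * - y)   ≡⟨ *-assoc b' c (- y) ⟨
    b' * c * - y     ∎)
    where
    open ≡-Reasoning
    bx≡-cy : b * x ≡ - (c * y)
    bx≡-cy = +-inverseˡ-unique (b * x) (c * y) (trans (cong (b * x +_) (sym (+-identityʳ (c * y)))) sum≡0)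

  hasZSBlock-[x,y]⇔ : ∀ x y → HasZSBlock p Sq (x ∷ y ∷ []) ⇔ (x ≡ 0# ⊎ y ≡ 0# ⊎ x ∼ - y)
  hasZSBlock-[x,y]⇔ x y = mk⇔ to from
    where
    to : HasZSBlock p Sq (x ∷ y ∷ []) → x ≡ 0# ⊎ y ≡ 0# ⊎ x ∼ - y
    to (_ , [] , _ , _ , () , _)
    to ([] , _ ∷ [] , _ , refl , zs) = inj₁ (wZeroSum-[x]⇒≡0 x zs)
    to ([] , _ ∷ _ ∷ [] , _ , refl , zs) = inj₂ (inj₂ (wZeroSum-[x,y]⇒∼ x y zs))
    to ([] , _ ∷ _ ∷ _ ∷ _ , _ , () , _)
    to (_ ∷ [] , _ ∷ [] , _ , refl , zs) = inj₂ (inj₁ (wZeroSum-[x]⇒≡0 y zs))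
    to (_ ∷ [] , _ ∷ _ ∷ _ , _ , () , _)
    to (_ ∷ _ ∷ [] , _ ∷ _ , _ , () , _)
    to (_ ∷ _ ∷ _ ∷ _ , _ ∷ _ , _ , () , _)

    from : x ≡ 0# ⊎ y ≡ 0# ⊎ x ∼ - y → HasZSBlock p Sq (x ∷ y ∷ [])
    from (inj₁ x≡0) = [] , x ∷ [] , y ∷ [] , refl , ≡0⇒wZeroSum-[x] x x≡0
    from (inj₂ (inj₁ y≡0)) = x ∷ [] , y ∷ [] , [] , refl , ≡0⇒wZeroSum-[x] y y≡0
    from (inj₂ (inj₂ x∼-y)) = [] , x ∷ y ∷ [] , [] , refl , ∼⇒wZeroSum-[x,y] x y x∼-y

  hasZSBlock-[x,y]? : ∀ x y → Dec (HasZSBlock p Sq (x ∷ y ∷ []))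
  hasZSBlock-[x,y]? x y = map′ from to (x ≟ 0# ⊎-dec y ≟ 0# ⊎-dec sameCoset? x (- y))
    where open Equivalence (hasZSBlock-[x,y]⇔ x y)

module ZpPrime (p : ℕ) .{{_ : NonZero p}} (p-prime : Prime p) where

  open ZpSquares p public

  1≢0 : 1# ≢ 0#
  1≢0 = ⟦⟧≢0 (s≤s z≤n) (ℕ.nonTrivial⇒n>1 p {{prime⇒nonTrivial p-prime}})

  unit⇒≢0 : ∀ x → Unit x → x ≢ 0#
  unit⇒≢0 x (y , xy≡1) x≡0 = 1≢0 (trans (sym xy≡1) (trans (cong (_* y) x≡0) (zeroˡ y)))

  ≢0⇒unit : ∀ x → x ≢ 0# → Unit x
  ≢0⇒unit x x≢0
    with coprime-Bézout (prime⇒coprime p-prime {{ℕ.≢-nonZero (x≢0 ∘ toℕ≡0⇒≡0 x)}} (toℕ<n x))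
  ... | Bézout.-+ a b 1+ap≡bn = ⟦ b ⟧ , (begin
    x * ⟦ b ⟧               ≡⟨ *-comm x ⟦ b ⟧ ⟩
    ⟦ b ⟧ * x               ≡⟨ ⟦⟧-*-toℕ b x ⟨
    ⟦ b ℕ.* toℕ x ⟧         ≡⟨ cong ⟦_⟧ 1+ap≡bn ⟨
    ⟦ 1 ℕ.+ a ℕ.* p ⟧       ≡⟨ ⟦⟧-+ 1 (a ℕ.* p) ⟩
    1# + ⟦ a ℕ.* p ⟧        ≡⟨ cong (1# +_) (⟦k*p⟧≡0 a) ⟩
    1# + 0#                 ≡⟨ +-identityʳ 1# ⟩
    1#                      ∎)
    where open ≡-Reasoning
  ... | Bézout.+- a b 1+bn≡ap = - ⟦ b ⟧ , (begin
    x * - ⟦ b ⟧             ≡⟨ -‿distribʳ-* x ⟦ b ⟧ ⟨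
    - (x * ⟦ b ⟧)           ≡⟨ cong -_ (trans (*-comm x ⟦ b ⟧) bx≡-1) ⟩
    - - 1#                  ≡⟨ -‿involutive 1# ⟩
    1#                      ∎)
    where
    open ≡-Reasoning
    1+bx≡0 : 1# + ⟦ b ⟧ * x ≡ 0#
    1+bx≡0 = begin
      1# + ⟦ b ⟧ * x        ≡⟨ cong (1# +_) (⟦⟧-*-toℕ b x) ⟨
      1# + ⟦ b ℕ.* toℕ x ⟧  ≡⟨ ⟦⟧-+ 1 (b ℕ.* toℕ x) ⟨
      ⟦ 1 ℕ.+ b ℕ.* toℕ x ⟧ ≡⟨ cong ⟦_⟧ 1+bn≡ap ⟩
      ⟦ a ℕ.* p ⟧           ≡⟨ ⟦k*p⟧≡0 a ⟩
      0#                    ∎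
    bx≡-1 : ⟦ b ⟧ * x ≡ - 1#
    bx≡-1 = +-inverseʳ-unique 1# (⟦ b ⟧ * x) 1+bx≡0

  ⟦⟧-unit : ∀ {n} → 0 ℕ.< n → n ℕ.< p → Unit ⟦ n ⟧
  ⟦⟧-unit {n} 0<n n<p = ≢0⇒unit ⟦ n ⟧ (⟦⟧≢0 0<n n<p)

  x*y≡0⇒x≡0∨y≡0 : ∀ x y → x * y ≡ 0# → x ≡ 0# ⊎ y ≡ 0#
  x*y≡0⇒x≡0∨y≡0 x y xy≡0 with x ≟ 0#
  ... | yes x≡0 = inj₁ x≡0
  ... | no x≢0 with ≢0⇒unit x x≢0
  ...   | x' , xx'≡1 = inj₂ (trans (unit-solveˡ x x' y xx'≡1 xy≡0) (zeroʳ x'))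

  x*x≡y*y⇒x+y≡0∨x≡y : ∀ x y → x * x ≡ y * y → x + y ≡ 0# ⊎ x ≡ y
  x*x≡y*y⇒x+y≡0∨x≡y x y x²≡y² =
    Sum.map₂ (x∙y⁻¹≈ε⇒x≈y x y) (x*y≡0⇒x≡0∨y≡0 (x + y) (x - y) (x*x≡y*y⇒[x+y][x-y]≡0 x y x²≡y²))

  ¬hasZSBlock-[x,y]⇔ : ∀ x y → (¬ HasZSBlock p Sq (x ∷ y ∷ [])) ⇔ (Unit x × Unit y × ¬ x ∼ - y)
  ¬hasZSBlock-[x,y]⇔ x y = mk⇔
    (λ ¬block → ≢0⇒unit x (¬block ∘ ⇒block ∘ inj₁) ,
                ≢0⇒unit y (¬block ∘ ⇒block ∘ inj₂ ∘ inj₁) ,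
                ¬block ∘ ⇒block ∘ inj₂ ∘ inj₂)
    (λ (ux , uy , x≁-y) → [ unit⇒≢0 x ux , [ unit⇒≢0 y uy , x≁-y ] ] ∘ block⇒)
    where open Equivalence (hasZSBlock-[x,y]⇔ x y) renaming (to to block⇒; from to ⇒block)

  squaresClosedUnderSuc⇒unitsSquare : (∀ e → Sq e → Unit (e + 1#) → Sq (e + 1#)) →
                                      ∀ x → Unit x → Sq x
  squaresClosedUnderSuc⇒unitsSquare closed x ux =
    let (k , 1+k<p , ⟦1+k⟧≡x) = ≢0⇒≡⟦1+k⟧ x (unit⇒≢0 x ux)
    in subst Sq ⟦1+k⟧≡x (⟦1+k⟧-square k 1+k<p)
    where
    ⟦1+k⟧-square : ∀ k → suc k ℕ.< p → Sq ⟦ suc k ⟧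
    ⟦1+k⟧-square zero    _      = square-1
    ⟦1+k⟧-square (suc k) 2+k<p  = subst Sq ⟦1+k⟧+1≡⟦2+k⟧
      (closed ⟦ suc k ⟧ (⟦1+k⟧-square k (ℕ.<-trans (ℕ.n<1+n (suc k)) 2+k<p))
                        (subst Unit (sym ⟦1+k⟧+1≡⟦2+k⟧) (⟦⟧-unit (s≤s z≤n) 2+k<p)))
      where
      ⟦1+k⟧+1≡⟦2+k⟧ : ⟦ suc k ⟧ + 1# ≡ ⟦ suc (suc k) ⟧
      ⟦1+k⟧+1≡⟦2+k⟧ = trans (sym (⟦⟧-+ (suc k) 1)) (cong ⟦_⟧ (ℕ.+-comm (suc k) 1))

  SquareBeforeNonsquare : Zp p → Set
  SquareBeforeNonsquare e = Sq e × Unit (e + 1#) × ¬ Sq (e + 1#)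

  squareBeforeNonsquare? : ∀ e → Dec (SquareBeforeNonsquare e)
  squareBeforeNonsquare? e = square? e ×-dec unit? (e + 1#) ×-dec ¬? (square? (e + 1#))

  nonsquare⇒∃squareBeforeNonsquare : ∀ q → Unit q → ¬ Sq q → ∃ SquareBeforeNonsquare
  nonsquare⇒∃squareBeforeNonsquare q uq ¬sq =
    Product.map₂ (λ {e} → decidable-stable (squareBeforeNonsquare? e))
      (¬∀⟶∃¬ p (¬_ ∘ SquareBeforeNonsquare) (¬? ∘ squareBeforeNonsquare?) (¬sq ∘ everyUnitSquare))
    where
    everyUnitSquare : (∀ e → ¬ SquareBeforeNonsquare e) → Sq q
    everyUnitSquare none = squaresClosedUnderSuc⇒unitsSquare
      (λ e se ue → decidable-stable (square? (e + 1#)) (λ ¬s → none e (se , ue , ¬s))) q uq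

  injectiveUnits-missingUnit⇒2+k≤p : ∀ {k} (f : Fin k → Zp p) → Injective _≡_ _≡_ f →
    (∀ i → Unit (f i)) → ∀ m → Unit m → (∀ i → f i ≢ m) → suc (suc k) ℕ.≤ p
  injectiveUnits-missingUnit⇒2+k≤p {k} f f-inj f-unit m um m∉f = injective⇒≤ g-inj
    where
    g : Fin (suc (suc k)) → Zp p
    g Fin.zero             = 0#
    g (Fin.suc Fin.zero)   = m
    g (Fin.suc (Fin.suc i)) = f i
    g-inj : Injective _≡_ _≡_ g
    g-inj {Fin.zero}            {Fin.zero}            _   = refl
    g-inj {Fin.zero}            {Fin.suc Fin.zero}    0≡m = contradiction (sym 0≡m) (unit⇒≢0 m um)
    g-inj {Fin.zero}            {Fin.suc (Fin.suc j)} 0≡f = contradiction (sym 0≡f) (unit⇒≢0 (f j) (f-unit j))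
    g-inj {Fin.suc Fin.zero}    {Fin.zero}            m≡0 = contradiction m≡0 (unit⇒≢0 m um)
    g-inj {Fin.suc Fin.zero}    {Fin.suc Fin.zero}    _   = refl
    g-inj {Fin.suc Fin.zero}    {Fin.suc (Fin.suc j)} m≡f = contradiction (sym m≡f) (m∉f j)
    g-inj {Fin.suc (Fin.suc i)} {Fin.zero}            f≡0 = contradiction f≡0 (unit⇒≢0 (f i) (f-unit i))
    g-inj {Fin.suc (Fin.suc i)} {Fin.suc Fin.zero}    f≡m = contradiction f≡m (m∉f i)
    g-inj {Fin.suc (Fin.suc i)} {Fin.suc (Fin.suc j)} f≡f = cong (Fin.suc ∘ Fin.suc) (f-inj f≡f)

module ZpOddPrime (p : ℕ) .{{_ : NonZero p}} (p-prime : Prime p) (h : ℕ) (p≡1+2h : p ≡ suc (h ℕ.+ h)) where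

  open ZpPrime p p-prime public

  half : Fin h → Zp p
  half k = ⟦ suc (toℕ k) ⟧

  toℕ-half : ∀ k → toℕ (half k) ≡ suc (toℕ k)
  toℕ-half k =
    toℕ-⟦⟧-< (subst (suc (toℕ k) ℕ.<_) (sym p≡1+2h) (s≤s (ℕ.≤-trans (toℕ<n k) (ℕ.m≤m+n h h))))

  half-unit : ∀ k → Unit (half k)
  half-unit k = ⟦⟧-unit (s≤s z≤n) (subst (ℕ._< p) (toℕ-half k) (toℕ<n (half k)))

  half+half≢0 : ∀ k k' → half k + half k' ≢ 0#
  half+half≢0 k k' sum≡0 = ℕ.1+n≢0 (begin
    suc (toℕ k) ℕ.+ suc (toℕ k')        ≡⟨ toℕ-⟦⟧-< sum<p ⟨
    toℕ ⟦ suc (toℕ k) ℕ.+ suc (toℕ k') ⟧ ≡⟨ cong toℕ (cong₂ (λ a b → ⟦ a ℕ.+ b ⟧) (toℕ-half k) (toℕ-half k')) ⟨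
    toℕ (half k + half k')              ≡⟨ cong toℕ sum≡0 ⟩
    toℕ 0#                              ≡⟨ toℕ-0 ⟩
    0                                   ∎)
    where
    open ≡-Reasoning
    sum<p : suc (toℕ k) ℕ.+ suc (toℕ k') ℕ.< p
    sum<p = subst (_ ℕ.<_) (sym p≡1+2h) (s≤s (ℕ.+-mono-≤ (toℕ<n k) (toℕ<n k')))

  half²-injective : ∀ k k' → half k * half k ≡ half k' * half k' → k ≡ k'
  half²-injective k k' sq≡sq =
    [ (λ sum≡0 → contradiction sum≡0 (half+half≢0 k k'))
    , (λ hk≡hk' → toℕ-injective (ℕ.suc-injective
                    (trans (sym (toℕ-half k)) (trans (cong toℕ hk≡hk') (toℕ-half k')))))
    ] (x*x≡y*y⇒x+y≡0∨x≡y (half k) (half k') sq≡sq)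

  -- The squares of 1, …, h and their multiples by the nonsquare n are 2h = p − 1 distinct
  -- units, so every unit is one of them.
  unit⇒square∨∼nonsquare : ∀ n m → Unit n → ¬ Sq n → Unit m → Sq m ⊎ m ∼ n
  unit⇒square∨∼nonsquare n m un ¬sn um =
    decidable-stable (square? m ⊎-dec sameCoset? m n) λ ¬found →
      ℕ.1+n≰n (subst (suc (suc (h ℕ.+ h)) ℕ.≤_) p≡1+2h
        (injectiveUnits-missingUnit⇒2+k≤p (g ∘ splitAt h) (splitAt-inj ∘ g-inj) (g-unit ∘ splitAt h)
           m um (λ i g≡m → ¬found (g-hits (splitAt h i) g≡m))))
    where
    half² : Fin h → Zp p
    half² k = half k * half k

    half²-square : ∀ k → Sq (half² k)
    half²-square k = x*x-square (half k) (half-unit k)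

    g : Fin h ⊎ Fin h → Zp p
    g (inj₁ k) = half² k
    g (inj₂ k) = half² k * n

    g-unit : ∀ s → Unit (g s)
    g-unit (inj₁ k) = square⇒unit (half² k) (half²-square k)
    g-unit (inj₂ k) = unit-* (half² k) n (square⇒unit (half² k) (half²-square k)) un

    ¬square≡square*n : ∀ k k' → half² k ≢ half² k' * n
    ¬square≡square*n k k' eq = ¬sn (square-cancelˡ (half² k') n (half²-square k') (subst Sq eq (half²-square k)))

    g-inj : Injective _≡_ _≡_ g
    g-inj {inj₁ k} {inj₁ k'} eq = cong inj₁ (half²-injective k k' eq)
    g-inj {inj₁ k} {inj₂ k'} eq = contradiction eq (¬square≡square*n k k')
    g-inj {inj₂ k} {inj₁ k'} eq = contradiction (sym eq) (¬square≡square*n k' k)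
    g-inj {inj₂ k} {inj₂ k'} eq = cong inj₂ (half²-injective k k' (unit-*-cancelʳ n (half² k) (half² k') un eq))

    splitAt-inj : Injective _≡_ _≡_ (splitAt h {h})
    splitAt-inj {i} {j} eq = trans (sym (join-splitAt h h i)) (trans (cong (join h h) eq) (join-splitAt h h j))

    g-hits : ∀ s → g s ≡ m → Sq m ⊎ m ∼ n
    g-hits (inj₁ k) gs≡m = inj₁ (subst Sq gs≡m (half²-square k))
    g-hits (inj₂ k) gs≡m = inj₂ (half² k , half²-square k , sym gs≡m)

  nonsquare*nonsquare-square : ∀ m n → Unit m → ¬ Sq m → Unit n → ¬ Sq n → Sq (m * n)
  nonsquare*nonsquare-square m n um ¬sm un ¬sn =
    [ (λ sm → contradiction sm ¬sm)
    , (λ (a , sa , m≡an) → subst Sq (trans (sym (*-assoc a n n)) (cong (_* n) (sym m≡an)))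
                             (square-* a (n * n) sa (x*x-square n un)))
    ] (unit⇒square∨∼nonsquare n m un ¬sn um)

  -- With e a square and e + 1 a nonsquare, the weights e q², s (e + 1) q, s q² are squares, and
  -- e q² · s w − s (e + 1) q · q w + s q² · w = 0.
  wZeroSum-[sw,-qw,w] : ∀ s q w → Sq s → Unit q → ¬ Sq q → WZeroSum p Sq (s * w ∷ - (q * w) ∷ w ∷ [])
  wZeroSum-[sw,-qw,w] s q w ss uq ¬sq =
    let (e , se , ue+1 , ¬se+1) = nonsquare⇒∃squareBeforeNonsquare q uq ¬sq
        sq² : Sq (q * q)
        sq² = x*x-square q uq
    in s≤s z≤n , e * (q * q) ∷ s * ((e + 1#) * q) ∷ s * (q * q) ∷ [] , refl ,
       square-* e (q * q) se sq² ∷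
       square-* s ((e + 1#) * q) ss (nonsquare*nonsquare-square (e + 1#) q ue+1 ¬se+1 uq ¬sq) ∷
       square-* s (q * q) ss sq² ∷ [] ,
       weightedSum≡0 e
    where
    weightedSum≡0 : ∀ e →
      e * (q * q) * (s * w) + (s * ((e + 1#) * q) * - (q * w) + (s * (q * q) * w + 0#)) ≡ 0#
    weightedSum≡0 e = begin
      a * (s * w) + (b * - (q * w) + (c * w + 0#))
        ≡⟨ cong (λ z → a * (s * w) + (z + (c * w + 0#))) (-‿distribʳ-* b (q * w)) ⟨
      a * (s * w) + (- (b * (q * w)) + (c * w + 0#))
        ≡⟨ cong (a * (s * w) +_) (trans (cong (- (b * (q * w)) +_) (+-identityʳ (c * w)))
                                        (+-comm (- (b * (q * w))) (c * w))) ⟩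
      a * (s * w) + (c * w - b * (q * w))
        ≡⟨ +-assoc (a * (s * w)) (c * w) (- (b * (q * w))) ⟨
      a * (s * w) + c * w - b * (q * w)
        ≡⟨ cong (_- b * (q * w)) balance ⟩
      b * (q * w) - b * (q * w)
        ≡⟨ -‿inverseʳ (b * (q * w)) ⟩
      0# ∎
      where
      open ≡-Reasoning
      a b c : Zp p
      a = e * (q * q)
      b = s * ((e + 1#) * q)
      c = s * (q * q)
      balance : a * (s * w) + c * w ≡ b * (q * w)
      balance = solve 4 (λ e q s w →
        (e :* (q :* q)) :* (s :* w) :+ (s :* (q :* q)) :* w := (s :* ((e :+ con 1) :* q)) :* (q :* w))
        refl e q s w

  threeTermZeroSum : ∀ u v w → Unit u → Unit v → Unit w → ¬ u ∼ - v → ¬ v ∼ - w →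
                     WZeroSum p Sq (u ∷ v ∷ w ∷ [])
  threeTermZeroSum u v w uu uv uw u≁-v v≁-w =
    let (r , ur , ¬sr , u≡r[-v]) = ¬sameCoset⇒nonsquareRatio u (- v) uu (unit-neg v uv) u≁-v
        (q , uq , ¬sq , v≡q[-w]) = ¬sameCoset⇒nonsquareRatio v (- w) uv (unit-neg w uw) v≁-w
        v≡-qw : v ≡ - (q * w)
        v≡-qw = trans v≡q[-w] (sym (-‿distribʳ-* q w))
        u≡rqw : u ≡ r * q * w
        u≡rqw = trans u≡r[-v] (trans (cong (λ z → r * - z) v≡-qw)
                  (trans (cong (r *_) (-‿involutive (q * w))) (sym (*-assoc r q w))))
    in subst₂ (λ u v → WZeroSum p Sq (u ∷ v ∷ w ∷ [])) (sym u≡rqw) (sym v≡-qw)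
         (wZeroSum-[sw,-qw,w] (r * q) q w (nonsquare*nonsquare-square r q ur ¬sr uq ¬sq) uq ¬sq)

  everyTripleHasZSBlock : Prop-k p Sq 3
  everyTripleHasZSBlock (u ∷ v ∷ w ∷ []) refl = fromPairs (hasZSBlock-[x,y]? u v) (hasZSBlock-[x,y]? v w)
    where
    fromPairs : Dec (HasZSBlock p Sq (u ∷ v ∷ [])) → Dec (HasZSBlock p Sq (v ∷ w ∷ [])) →
                HasZSBlock p Sq (u ∷ v ∷ w ∷ [])
    fromPairs (yes uvBlock) _             = hasZSBlock-++ʳ p (w ∷ []) uvBlock
    fromPairs (no _)        (yes vwBlock) = hasZSBlock-++ˡ p (u ∷ []) vwBlock
    fromPairs (no ¬uvBlock) (no ¬vwBlock) =
      let (uu , uv , u≁-v) = Equivalence.to (¬hasZSBlock-[x,y]⇔ u v) ¬uvBlock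
          (_ , uw , v≁-w) = Equivalence.to (¬hasZSBlock-[x,y]⇔ v w) ¬vwBlock
      in [] , u ∷ v ∷ w ∷ [] , [] , refl , threeTermZeroSum u v w uu uv uw u≁-v v≁-w

prime≢2⇒≡1+2h : ∀ {p} → Prime p → p ≢ 2 → ∃ λ h → p ≡ suc (h ℕ.+ h)
prime≢2⇒≡1+2h {p} p-prime p≢2 = fromParity (p % 2) refl (m%n<n p 2)
  where
  fromParity : ∀ r → p % 2 ≡ r → r ℕ.< 2 → ∃ λ h → p ≡ suc (h ℕ.+ h)
  fromParity zero p%2≡0 _ with prime⇒irreducible p-prime (m%n≡0⇒n∣m p 2 p%2≡0)
  ... | inj₁ ()
  ... | inj₂ 2≡p = contradiction (sym 2≡p) p≢2
  fromParity (suc zero) p%2≡1 _ = p ℕ./ 2 , (begin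
    p                                  ≡⟨ m≡m%n+[m/n]*n p 2 ⟩
    p % 2 ℕ.+ p ℕ./ 2 ℕ.* 2            ≡⟨ cong (ℕ._+ p ℕ./ 2 ℕ.* 2) p%2≡1 ⟩
    suc (p ℕ./ 2 ℕ.* 2)                ≡⟨ cong suc (ℕ.*-comm (p ℕ./ 2) 2) ⟩
    suc (p ℕ./ 2 ℕ.+ (p ℕ./ 2 ℕ.+ 0))  ≡⟨ cong (λ m → suc (p ℕ./ 2 ℕ.+ m)) (ℕ.+-identityʳ (p ℕ./ 2)) ⟩
    suc (p ℕ./ 2 ℕ.+ p ℕ./ 2)          ∎)
    where open ≡-Reasoning
  fromParity (suc (suc _)) _ (s≤s (s≤s ()))

mainTheorem8 : (p : ℕ) .{{_ : NonZero p}} → Prime p → p ≢ 2 →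
    (x y : Zp p) →
    Extremal p (InSquares p) (x ∷ y ∷ []) ⇔
      (IsUnit p x × IsUnit p y × ¬ SameCoset p (InSquares p) x (-ₚ_ p y))
mainTheorem8 p p-prime p≢2 x y =
  mk⇔ (λ (_ , _ , _ , ¬block) → to ¬block) (blockless⇒extremal p everyTripleHasZSBlock ∘ from)
  where
  p≡1+2h : ∃ λ h → p ≡ suc (h ℕ.+ h)
  p≡1+2h = prime≢2⇒≡1+2h p-prime p≢2
  open ZpOddPrime p p-prime (proj₁ p≡1+2h) (proj₂ p≡1+2h)
  open Equivalence (¬hasZSBlock-[x,y]⇔ x y)
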